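{- Let $G$ be a connected $(P_5,\text{chair})$-free graph and let $C=v_1v_2v_3v_4v_5$ be an induced $C_5$ in $G$ (indices modulo 5). Then for every $1\le i\le 5$, the sets $S_1(i)=\{v\in V(G)\setminus V(C): N_C(v)=\{v_i\}\}$, $S^1_2(i)=\{v\in V(G)\setminus V(C): N_C(v)=\{v_i,v_{i+1}\}\}$ and $S^2_2(i)=\{v\in V(G)\setminus V(C): N_C(v)=\{v_i,v_{i+2}\}\}$ are all empty.
   Context: Graphs are finite and simple. $P_5$ is the path on 5 vertices; a chair is a $P_4$ with an additional vertex adjacent to exactly one of the two middle vertices of the $P_4$. $G$ is $(P_5,\text{chair})$-free if it has no induced subgraph isomorphic to $P_5$ or to the chair. $N_C(v)=N(v)\cap V(C)$. -}

module Defs where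

open import Data.Nat using (ℕ; suc)
open import Data.Fin using (Fin; zero; suc; toℕ)
open import Data.Fin.Properties using ()
open import Data.Nat.DivMod using (_mod_)
open import Data.Nat using (_+_)
open import Data.Product using (Σ; _×_; _,_; ∃)
open import Data.Sum using (_⊎_)
open import Data.List using (List; []; _∷_)
open import Relation.Nullary using (¬_)
open import Relation.Binary.PropositionalEquality using (_≡_)
open import Function.Bundles using (_⇔_)
open import Function.Definitions using (Injective)

record Graph (n : ℕ) : Set₁ where
  field
    Adj   : Fin n → Fin n → Set
    sym   : ∀ {u v} → Adj u v → Adj v u
    irrefl : ∀ {u} → ¬ Adj u u
open Graph public

P5-adj : Fin 5 → Fin 5 → Set
P5-adj i j = (suc (toℕ i) ≡ toℕ j) ⊎ (suc (toℕ j) ≡ toℕ i)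

chair-adj : Fin 5 → Fin 5 → Set
chair-adj i j =
  (toℕ i ≡ 0 × toℕ j ≡ 1) ⊎ (toℕ i ≡ 1 × toℕ j ≡ 0) ⊎
  (toℕ i ≡ 1 × toℕ j ≡ 2) ⊎ (toℕ i ≡ 2 × toℕ j ≡ 1) ⊎
  (toℕ i ≡ 2 × toℕ j ≡ 3) ⊎ (toℕ i ≡ 3 × toℕ j ≡ 2) ⊎
  (toℕ i ≡ 1 × toℕ j ≡ 4) ⊎ (toℕ i ≡ 4 × toℕ j ≡ 1)

next5 : Fin 5 → Fin 5
next5 i = (suc (toℕ i)) mod 5

C5-adj : Fin 5 → Fin 5 → Set
C5-adj i j = (next5 i ≡ j) ⊎ (next5 j ≡ i)

IsInducedCopy : ∀ {n k} → Graph n → (Fin k → Fin k → Set) → (Fin k → Fin n) → Set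
IsInducedCopy G H f = Injective _≡_ _≡_ f × (∀ i j → Adj G (f i) (f j) ⇔ H i j)

HasInduced : ∀ {n k} → Graph n → (Fin k → Fin k → Set) → Set
HasInduced {n} {k} G H = Σ (Fin k → Fin n) (IsInducedCopy G H)

P5ChairFree : ∀ {n} → Graph n → Set
P5ChairFree G = ¬ HasInduced G P5-adj × ¬ HasInduced G chair-adj

data Walk {n} (G : Graph n) : Fin n → Fin n → Set where
  here : ∀ {u} → Walk G u u
  step : ∀ {u w v} → Adj G u w → Walk G w v → Walk G u v

Connected : ∀ {n} → Graph n → Set
Connected {n} G = ∀ (u v : Fin n) → Walk G u v

NbrOnCIs : ∀ {n} → Graph n → (Fin 5 → Fin n) → Fin n → (Fin 5 → Set) → Set
NbrOnCIs G c v S = (∀ j → ¬ v ≡ c j) × (∀ j → Adj G v (c j) ⇔ S j)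

∃Vtx : ∀ {n} → Graph n → (Fin n → Set) → Set
∃Vtx {n} G P = Σ (Fin n) P

-- A vertex v outside C whose neighbourhood on C is {v_i}, {v_i, v_{i+1}} or
-- {v_i, v_{i+2}} spans, together with four vertices of C, an induced P5
-- (v v_i v_{i+1} v_{i+2} v_{i+3}, resp. v v_{i+1} v_{i+2} v_{i+3} v_{i+4}) or an
-- induced chair (v v_i v_{i+4} v_{i+3} with pendant v_{i+1}).  These are finite
-- facts about the six-vertex graph C + v, checked by evaluation, and induced
-- embeddings compose.
module Submission where

open import Defs
open import Data.Nat as ℕ using (ℕ)
open import Data.Nat.DivMod using (_mod_)
open import Data.Fin using (Fin; toℕ) renaming (_≟_ to _≟ᶠ_)
open import Data.Fin.Properties using (all?)
open import Data.Maybe using (Maybe; just; nothing; maybe′)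
open import Data.Maybe.Properties using () renaming (≡-dec to ≡-decᴹ)
open import Data.Vec using ([]; _∷_; lookup)
open import Data.Empty using (⊥; ⊥-elim)
open import Data.Product using (_×_; _,_; uncurry)
open import Data.Sum using (_⊎_)
open import Relation.Nullary using (¬_; Dec; no)
open import Relation.Nullary.Decidable using (True; map′; toWitness; _⊎-dec_; _×-dec_; _→-dec_)
open import Relation.Binary.PropositionalEquality using (_≡_; refl; cong) renaming (sym to ≡-sym)
open import Function using (_∘_)
open import Function.Bundles using (_⇔_; mk⇔; Equivalence)
open import Function.Definitions using (Injective)
open import Function.Construct.Composition using (_⇔-∘_)

-- IsInducedCopy G H is, by definition, InducedEmbedding H (Adj G).
InducedEmbedding : {X Y : Set} → (X → X → Set) → (Y → Y → Set) → (X → Y) → Set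
InducedEmbedding {X} A B f = Injective _≡_ _≡_ f × (∀ (x y : X) → B (f x) (f y) ⇔ A x y)

InducedEmbedding-∘ : {X Y Z : Set} {A : X → X → Set} {B : Y → Y → Set} {C : Z → Z → Set}
                     {f : X → Y} {g : Y → Z} →
                     InducedEmbedding B C g → InducedEmbedding A B f →
                     InducedEmbedding A C (g ∘ f)
InducedEmbedding-∘ {f = f} (g-inj , g-adj) (f-inj , f-adj) =
  f-inj ∘ g-inj , λ x y → f-adj x y ⇔-∘ g-adj (f x) (f y)

C5+vertex : (Fin 5 → Set) → Maybe (Fin 5) → Maybe (Fin 5) → Set
C5+vertex S nothing  nothing  = ⊥
C5+vertex S nothing  (just j) = S j
C5+vertex S (just i) nothing  = S i
C5+vertex S (just i) (just j) = C5-adj i j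

C5+vertex-embedding : ∀ {n} (G : Graph n) {c : Fin 5 → Fin n} {v : Fin n} {S : Fin 5 → Set} →
                      IsInducedCopy G C5-adj c → NbrOnCIs G c v S →
                      InducedEmbedding (C5+vertex S) (Adj G) (maybe′ c v)
C5+vertex-embedding G {c} {v} {S} (c-inj , c-adj) (v∉C , v-adj) = injective , adjacency
  where
  injective : Injective _≡_ _≡_ (maybe′ c v)
  injective {nothing} {nothing} _  = refl
  injective {nothing} {just j}  eq = ⊥-elim (v∉C j eq)
  injective {just i}  {nothing} eq = ⊥-elim (v∉C i (≡-sym eq))
  injective {just i}  {just j}  eq = cong just (c-inj eq)

  adjacency : ∀ x y → Adj G (maybe′ c v x) (maybe′ c v y) ⇔ C5+vertex S x y
  adjacency nothing  nothing  = mk⇔ (irrefl G) λ ()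
  adjacency nothing  (just j) = v-adj j
  adjacency (just i) nothing  = v-adj i ⇔-∘ mk⇔ (sym G) (sym G)
  adjacency (just i) (just j) = c-adj i j

_⇔-dec_ : {A B : Set} → Dec A → Dec B → Dec (A ⇔ B)
a? ⇔-dec b? = map′ (uncurry mk⇔) (λ e → Equivalence.to e , Equivalence.from e)
                   ((a? →-dec b?) ×-dec (b? →-dec a?))

InducedEmbedding-dec : {Y : Set} {A : Fin 5 → Fin 5 → Set} {B : Y → Y → Set} →
                       (∀ x y → Dec (A x y)) → (∀ x y → Dec (B x y)) →
                       (∀ (x y : Y) → Dec (x ≡ y)) →
                       (f : Fin 5 → Y) → Dec (InducedEmbedding A B f)
InducedEmbedding-dec A? B? _≟_ f = injective? ×-dec all? λ x → all? λ y → B? (f x) (f y) ⇔-dec A? x y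
  where
  injective? : Dec (Injective _≡_ _≡_ f)
  injective? = map′ (λ inj {x} {y} → inj x y) (λ inj x y → inj {x} {y})
                    (all? λ x → all? λ y → (f x ≟ f y) →-dec (x ≟ᶠ y))

C5-adj-dec : ∀ i j → Dec (C5-adj i j)
C5-adj-dec i j = (next5 i ≟ᶠ j) ⊎-dec (next5 j ≟ᶠ i)

C5+vertex-dec : {S : Fin 5 → Set} → (∀ j → Dec (S j)) → ∀ x y → Dec (C5+vertex S x y)
C5+vertex-dec S? nothing  nothing  = no λ ()
C5+vertex-dec S? nothing  (just j) = S? j
C5+vertex-dec S? (just i) nothing  = S? i
C5+vertex-dec S? (just i) (just j) = C5-adj-dec i j

P5-adj-dec : ∀ a b → Dec (P5-adj a b)
P5-adj-dec a b = (ℕ.suc (toℕ a) ℕ.≟ toℕ b) ⊎-dec (ℕ.suc (toℕ b) ℕ.≟ toℕ a)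

chair-adj-dec : ∀ a b → Dec (chair-adj a b)
chair-adj-dec a b =
  (a ≐ 0 ×-dec b ≐ 1) ⊎-dec (a ≐ 1 ×-dec b ≐ 0) ⊎-dec
  (a ≐ 1 ×-dec b ≐ 2) ⊎-dec (a ≐ 2 ×-dec b ≐ 1) ⊎-dec
  (a ≐ 2 ×-dec b ≐ 3) ⊎-dec (a ≐ 3 ×-dec b ≐ 2) ⊎-dec
  (a ≐ 1 ×-dec b ≐ 4) ⊎-dec (a ≐ 4 ×-dec b ≐ 1)
  where
  _≐_ : (x : Fin 5) (k : ℕ) → Dec (toℕ x ≡ k)
  x ≐ k = toℕ x ℕ.≟ k

byEvaluation : {P : Fin 5 → Set} (P? : ∀ i → Dec (P i)) → {True (all? P?)} → ∀ i → P i
byEvaluation P? {p} = toWitness p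

_⊕_ : Fin 5 → ℕ → Fin 5
i ⊕ k = (toℕ i ℕ.+ k) mod 5

path-from-S₁ : ∀ i → InducedEmbedding P5-adj (C5+vertex (λ j → j ≡ i))
  (lookup (nothing ∷ just i ∷ just (i ⊕ 1) ∷ just (i ⊕ 2) ∷ just (i ⊕ 3) ∷ []))
path-from-S₁ = byEvaluation λ i →
  InducedEmbedding-dec P5-adj-dec (C5+vertex-dec (_≟ᶠ i)) (≡-decᴹ _≟ᶠ_) _

path-from-S¹₂ : ∀ i → InducedEmbedding P5-adj (C5+vertex (λ j → j ≡ i ⊎ j ≡ next5 i))
  (lookup (nothing ∷ just (i ⊕ 1) ∷ just (i ⊕ 2) ∷ just (i ⊕ 3) ∷ just (i ⊕ 4) ∷ []))
path-from-S¹₂ = byEvaluation λ i →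
  InducedEmbedding-dec P5-adj-dec (C5+vertex-dec λ j → (j ≟ᶠ i) ⊎-dec (j ≟ᶠ next5 i)) (≡-decᴹ _≟ᶠ_) _

chair-from-S²₂ : ∀ i → InducedEmbedding chair-adj (C5+vertex (λ j → j ≡ i ⊎ j ≡ next5 (next5 i)))
  (lookup (nothing ∷ just i ∷ just (i ⊕ 4) ∷ just (i ⊕ 3) ∷ just (i ⊕ 1) ∷ []))
chair-from-S²₂ = byEvaluation λ i →
  InducedEmbedding-dec chair-adj-dec (C5+vertex-dec λ j → (j ≟ᶠ i) ⊎-dec (j ≟ᶠ next5 (next5 i))) (≡-decᴹ _≟ᶠ_) _

claim1 : ∀ {n} (G : Graph n) → Connected G → P5ChairFree G →
         (c : Fin 5 → Fin n) → IsInducedCopy G C5-adj c →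
         (i : Fin 5) →
           (¬ (∃Vtx G λ v → NbrOnCIs G c v (λ j → j ≡ i)))
         × (¬ (∃Vtx G λ v → NbrOnCIs G c v (λ j → j ≡ i ⊎ j ≡ next5 i)))
         × (¬ (∃Vtx G λ v → NbrOnCIs G c v (λ j → j ≡ i ⊎ j ≡ next5 (next5 i))))
claim1 G _ (P5-free , chair-free) c C-induced i =
    (λ (v , N-v) → P5-free    (_ , through v N-v (path-from-S₁ i)))
  , (λ (v , N-v) → P5-free    (_ , through v N-v (path-from-S¹₂ i)))
  , (λ (v , N-v) → chair-free (_ , through v N-v (chair-from-S²₂ i)))
  where
  through : ∀ {H : Fin 5 → Fin 5 → Set} {S : Fin 5 → Set} {f : Fin 5 → Maybe (Fin 5)} v →
            NbrOnCIs G c v S → InducedEmbedding H (C5+vertex S) f →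
            InducedEmbedding H (Adj G) (maybe′ c v ∘ f)
  through {H} {S} {f} v N-v =
    InducedEmbedding-∘ {A = H} {B = C5+vertex S} {C = Adj G} {f = f} {g = maybe′ c v}
      (C5+vertex-embedding G {c} {v} {S} C-induced N-v)
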